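{- Let $\sigma\in S_n$ and let $A,B$ be disjoint $k$-sets with $\sigma_{\langle A\rangle}=\sigma_{\langle B\rangle}$; consider the chain graph of $\sigma$ for $A$ and $B$. If $C_1$ and $C_2$ are increasing chains that overlap (horizontally or vertically) and $C'$ is a decreasing chain, then there do not exist points $q_1,q_2$ of $C'$ such that $q_1$ cuts an edge of $C_1$ horizontally and $q_2$ cuts an edge of $C_2$ vertically.
   Context: $S_n$ is the set of permutations of $[n]$. Points of $\sigma$ are $(i,\sigma(i))$, identified with positions $i$ and ordered left to right. For $A\subset[n]$, $\sigma_{\langle A\rangle}$ is the permutation in the same relative order as the word obtained by deleting the entries at positions in $A$; if $[n]\setminus A=\{i_1<\dots<i_r\}$, the $i_j$th entry of $\sigma$ fulfills the $j$th entry of $\sigma_{\langle A\rangle}$. For disjoint $k$-sets $A,B$ with $\sigma_{\langle A\rangle}=\sigma_{\langle B\rangle}$, the chain graph has vertex set the points of $\sigma$; for each $i\in[n-k]$ an edge joins the point fulfilling the $i$th entry of $\sigma_{\langle A\rangle}$ and the point fulfilling the $i$th entry of $\sigma_{\langle B\rangle}$ when these differ. The chains are the connected components with at least one edge; each is a path. A chain is increasing if every edge $pp'$ with $p$ left of $p'$ has $\sigma(p)<\sigma(p')$, decreasing if every such edge has $\sigma(p)>\sigma(p')$. Chains $C,C'$ with left end-vertices $\ell,\ell'$ and right end-vertices $r,r'$ overlap horizontally if $\ell<r'$ and $\ell'<r$; with lower end-vertices $b,b'$ and upper end-vertices $t,t'$ they overlap vertically if $\sigma(b)<\sigma(t')$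 and $\sigma(b')<\sigma(t)$. For distinct points $p,p'$, a point $q$ cuts $pp'$ horizontally if its value lies strictly between $\sigma(p),\sigma(p')$, and vertically if its position lies strictly between the positions of $p,p'$ (a point with both properties cuts both horizontally and vertically). -}

module Defs where

open import Data.Nat using (ℕ)
open import Data.Fin using (Fin; _<_)
open import Data.Fin.Properties using (_<?_)
open import Data.Fin.Subset using (Subset; _∈_; _∉_; _∩_; Empty; ∣_∣)
open import Data.Fin.Subset.Properties using (_∈?_)
open import Data.Fin.Permutation using (Permutation′; _⟨$⟩ʳ_)
open import Data.List using (List; map; filter; allFin; length; zip)
open import Data.List.Membership.Propositional using () renaming (_∈_ to _∈ₗ_)
open import Data.Product using (_×_; _,_; ∃; ∃-syntax)
open import Data.Sum using (_⊎_)
open import Relation.Nullary using (¬_; ¬?)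
open import Relation.Binary.PropositionalEquality using (_≡_; _≢_)
open import Relation.Binary.Construct.Closure.ReflexiveTransitive using (Star)

private variable n : ℕ

-- Points of σ are identified with their positions i : Fin n (0-based);
-- the point at position i has value σ i.
val : Permutation′ n → Fin n → Fin n
val σ i = σ ⟨$⟩ʳ i

Disjoint : Subset n → Subset n → Set
Disjoint A B = Empty (A ∩ B)

-- Positions not in A, listed increasingly: i₁ < … < i_r.
-- The j-th entry of this list is the point fulfilling the j-th entry of σ⟨A⟩.
remaining : Subset n → List (Fin n)
remaining {n} A = filter (λ i → ¬? (i ∈? A)) (allFin n)

standardize : List (Fin n) → List ℕ
standardize w = map (λ y → length (filter (_<? y) w)) w

-- σ⟨A⟩: the permutation in the same relative order as the word obtained
-- from σ by deleting the entries at positions in A.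
reduce : Permutation′ n → Subset n → List ℕ
reduce σ A = standardize (map (val {_} σ) (remaining A))

-- Chain graph for A and B: for each index i, an edge joins the i-th entry
-- of remaining A and the i-th entry of remaining B when they differ.
-- (Undirected: Edge p q holds iff the pair appears in either orientation.)
Edge : Subset n → Subset n → Fin n → Fin n → Set
Edge A B p q = p ≢ q × (((p , q) ∈ₗ zip (remaining A) (remaining B))
                       ⊎ ((q , p) ∈ₗ zip (remaining A) (remaining B)))

-- A chain is a connected component with at least one edge.  We represent a
-- chain by any of its vertices v (incident to some edge); its vertex set is
-- the set of points reachable from v in the chain graph.
IsChainVertex : Subset n → Subset n → Fin n → Set
IsChainVertex A B v = ∃[ w ] Edge A B v w

InChain : Subset n → Subset n → Fin n → Fin n → Set
InChain A B v p = Star (Edge A B) v p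

ChainEdge : Subset n → Subset n → Fin n → Fin n → Fin n → Set
ChainEdge A B v p p' = InChain A B v p × Edge A B p p'

Increasing : Permutation′ n → Subset n → Subset n → Fin n → Set
Increasing σ A B v = ∀ p p' → ChainEdge A B v p p' → p < p' → val σ p < val σ p'

Decreasing : Permutation′ n → Subset n → Subset n → Fin n → Set
Decreasing σ A B v = ∀ p p' → ChainEdge A B v p p' → p < p' → val σ p' < val σ p

EndVertex : Subset n → Subset n → Fin n → Fin n → Set
EndVertex A B v e = InChain A B v e × ∃[ w ] (Edge A B e w × (∀ w' → Edge A B e w' → w' ≡ w))

OverlapH : Subset n → Subset n → Fin n → Fin n → Set
OverlapH A B v v' = ∃[ ℓ ] ∃[ r ] ∃[ ℓ' ] ∃[ r' ]
  (EndVertex A B v ℓ × EndVertex A B v r × ℓ < r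
  × EndVertex A B v' ℓ' × EndVertex A B v' r' × ℓ' < r'
  × ℓ < r' × ℓ' < r)

OverlapV : Permutation′ n → Subset n → Subset n → Fin n → Fin n → Set
OverlapV σ A B v v' = ∃[ b ] ∃[ t ] ∃[ b' ] ∃[ t' ]
  (EndVertex A B v b × EndVertex A B v t × val σ b < val σ t
  × EndVertex A B v' b' × EndVertex A B v' t' × val σ b' < val σ t'
  × val σ b < val σ t' × val σ b' < val σ t)

Between : Fin n → Fin n → Fin n → Set
Between x y z = (x < y × y < z) ⊎ (z < y × y < x)

CutsH : Permutation′ n → Fin n → Fin n → Fin n → Set
CutsH σ q p p' = Between (val σ p) (val σ q) (val σ p')

CutsV : Fin n → Fin n → Fin n → Set
CutsV q p p' = Between p q p'

-- Match the i-th remaining point of A with the i-th remaining point of B.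
-- Both lists are increasing, and σ⟨A⟩ = σ⟨B⟩, so this matching preserves the
-- left-to-right and the bottom-to-top order of points.  Orient every edge
-- from its A-end to its B-end.  Order preservation forces
--   * adjacent edges, hence all edges of a chain, to point the same horizontal way;
--   * an edge through q to point the same horizontal (vertical) way as an edge
--     that q cuts vertically (horizontally);
--   * two chains that both straddle some level to point the same way there.
-- Along an increasing chain the horizontal and vertical directions agree, along
-- a decreasing one they are opposite.  Going C₁ → C₂ → q₂ → C′ → q₁ → C₁ the
-- directions of C′ would have to agree and disagree at once.
module Submission where

open import Defs
open import Data.Bool using (Bool; true; false; not)
open import Data.Bool.Properties using (not-¬)
open import Data.Empty using (⊥; ⊥-elim)
open import Data.Fin using (Fin; _<_; _≤_)
open import Data.Fin.Properties using (_<?_; _≤?_; <-cmp)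
open import Data.Fin.Subset using (Subset; ∣_∣)
open import Data.Fin.Permutation using (Permutation′)
open import Data.List using (List; _∷_; map; filter; zip; length)
open import Data.List.Membership.Propositional using () renaming (_∈_ to _∈ₗ_)
open import Data.List.Membership.Propositional.Properties using (∈-filter⁺; ∈-filter⁻)
open import Data.List.Properties using (∷-injectiveˡ; ∷-injectiveʳ)
open import Data.List.Relation.Binary.Pointwise using (Pointwise-≡⇒≡)
open import Data.List.Relation.Binary.Sublist.Propositional using (_⊆_; ⊆-reflexive)
open import Data.List.Relation.Binary.Sublist.Propositional.Properties using (filter⁺; length-mono-≤; to-≋)
open import Data.List.Relation.Unary.Any using (here; there)
import Data.List.Relation.Unary.All as All
open import Data.List.Relation.Unary.AllPairs using (AllPairs; _∷_)
import Data.List.Relation.Unary.AllPairs.Properties as AllPairs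
open import Data.Nat using (ℕ) renaming (_≤_ to _≤ℕ_; _<_ to _<ℕ_)
import Data.Nat.Properties as ℕ
open import Data.Product using (_×_; _,_; proj₁; proj₂; Σ; ∃-syntax)
open import Data.Sum using (_⊎_; inj₁; inj₂; swap)
open import Function using (id)
open import Relation.Binary using (Rel; tri<; tri≈; tri>)
open import Relation.Binary.PropositionalEquality
  using (_≡_; _≢_; refl; sym; trans; cong; subst; module ≡-Reasoning)
open import Relation.Binary.Construct.Closure.ReflexiveTransitive using (Star; ε; _◅_; _◅◅_; reverse)
open import Relation.Nullary using (¬_; yes; no; does)
open import Relation.Nullary.Decidable using (dec-true; dec-false)

private variable
  m : ℕ
  X Y : Set

zip-∈ˡ : ∀ {xs : List X} {ys : List Y} {x y} → (x , y) ∈ₗ zip xs ys → x ∈ₗ xs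
zip-∈ˡ {xs = _ ∷ _} {_ ∷ _} (here refl) = here refl
zip-∈ˡ {xs = _ ∷ _} {_ ∷ _} (there i)   = there (zip-∈ˡ i)

zip-∈ʳ : ∀ {xs : List X} {ys : List Y} {x y} → (x , y) ∈ₗ zip xs ys → y ∈ₗ ys
zip-∈ʳ {xs = _ ∷ _} {_ ∷ _} (here refl) = here refl
zip-∈ʳ {xs = _ ∷ _} {_ ∷ _} (there i)   = there (zip-∈ʳ i)

zip-∈-swap : ∀ {xs : List X} {ys : List Y} {x y} → (x , y) ∈ₗ zip xs ys → (y , x) ∈ₗ zip ys xs
zip-∈-swap {xs = _ ∷ _} {_ ∷ _} (here refl) = here refl
zip-∈-swap {xs = _ ∷ _} {_ ∷ _} (there i)   = there (zip-∈-swap i)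

zip-∈-map : ∀ {Z : Set} (f : X → Z) {xs ys : List X} {x y} →
  (x , y) ∈ₗ zip xs ys → (f x , f y) ∈ₗ zip (map f xs) (map f ys)
zip-∈-map f {_ ∷ _} {_ ∷ _} (here refl) = here refl
zip-∈-map f {_ ∷ _} {_ ∷ _} (there i)   = there (zip-∈-map f i)

map-≡⇒zip-≡ : ∀ {Z : Set} (f : X → Z) (g : Y → Z) {xs ys x y} →
  map f xs ≡ map g ys → (x , y) ∈ₗ zip xs ys → f x ≡ g y
map-≡⇒zip-≡ f g {_ ∷ _} {_ ∷ _} eq (here refl) = ∷-injectiveˡ eq
map-≡⇒zip-≡ f g {_ ∷ _} {_ ∷ _} eq (there i)   = map-≡⇒zip-≡ f g (∷-injectiveʳ eq) i

ZipMonotone : (Fin m → Fin m) → List (Fin m) → List (Fin m) → Set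
ZipMonotone κ xs ys = ∀ {a b a' b'} → (a , b) ∈ₗ zip xs ys → (a' , b') ∈ₗ zip xs ys →
  κ a < κ a' → κ b < κ b'

sorted⇒zipMonotone : {xs ys : List (Fin m)} → AllPairs _<_ xs → AllPairs _<_ ys → ZipMonotone id xs ys
sorted⇒zipMonotone {xs = _ ∷ _} {_ ∷ _} _ _ (here refl) (here refl) x<x = ⊥-elim (ℕ.<-irrefl refl x<x)
sorted⇒zipMonotone {xs = _ ∷ _} {_ ∷ _} _ (y<ys ∷ _) (here refl) (there i') _ = All.lookup y<ys (zip-∈ʳ i')
sorted⇒zipMonotone {xs = _ ∷ _} {_ ∷ _} (x<xs ∷ _) _ (there i) (here refl) a<x =
  ⊥-elim (ℕ.<-asym a<x (All.lookup x<xs (zip-∈ˡ i)))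
sorted⇒zipMonotone {xs = _ ∷ _} {_ ∷ _} (_ ∷ xs<) (_ ∷ ys<) (there i) (there i') =
  sorted⇒zipMonotone xs< ys< i i'

zipMonotone-map : (κ : Fin m → Fin m) {xs ys : List (Fin m)} →
  ZipMonotone id (map κ xs) (map κ ys) → ZipMonotone κ xs ys
zipMonotone-map κ mono i i' = mono (zip-∈-map κ i) (zip-∈-map κ i')

remaining-sorted : (C : Subset m) → AllPairs _<_ (remaining C)
remaining-sorted C = AllPairs.filter⁺ _ (AllPairs.tabulate⁺-< id)

rank : List (Fin m) → Fin m → ℕ
rank w y = length (filter (_<? y) w)

filter-<-⊆ : (w : List (Fin m)) {x y : Fin m} → x ≤ y → filter (_<? x) w ⊆ filter (_<? y) w
filter-<-⊆ w {x} {y} x≤y =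
  filter⁺ (_<? x) (_<? y) (λ { refl z<x → ℕ.<-≤-trans z<x x≤y }) (⊆-reflexive (refl {x = w}))

rank-mono : (w : List (Fin m)) {x y : Fin m} → x ≤ y → rank w x ≤ℕ rank w y
rank-mono w x≤y = length-mono-≤ (filter-<-⊆ w x≤y)

-- Equal ranks would make the two filtered lists equal, but only one contains x.
rank-strict : (w : List (Fin m)) {x y : Fin m} → x ∈ₗ w → x < y → rank w x <ℕ rank w y
rank-strict w {x} {y} x∈w x<y = ℕ.≤∧≢⇒< (rank-mono w (ℕ.<⇒≤ x<y)) ranks-differ
  where
  ranks-differ : rank w x ≢ rank w y
  ranks-differ eq = ℕ.<-irrefl refl (proj₂ (∈-filter⁻ (_<? x) {xs = w} (subst (x ∈ₗ_) (sym same) x∈<y)))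
    where
    same : filter (_<? x) w ≡ filter (_<? y) w
    same = Pointwise-≡⇒≡ (to-≋ eq (filter-<-⊆ w (ℕ.<⇒≤ x<y)))
    x∈<y : x ∈ₗ filter (_<? y) w
    x∈<y = ∈-filter⁺ (_<? y) x∈w x<y

standardize≡⇒zipMonotone : {u v : List (Fin m)} → standardize u ≡ standardize v → ZipMonotone id u v
standardize≡⇒zipMonotone {u = u} {v} eq {a} {b} {a'} {b'} i i' a<a' with b <? b'
... | yes b<b' = b<b'
... | no b≮b' = ⊥-elim (ℕ.<-irrefl refl (begin-strict
      rank v b   ≡⟨ map-≡⇒zip-≡ (rank u) (rank v) eq i ⟨
      rank u a   <⟨ rank-strict u (zip-∈ˡ i) a<a' ⟩
      rank u a'  ≡⟨ map-≡⇒zip-≡ (rank u) (rank v) eq i' ⟩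
      rank v b'  ≤⟨ rank-mono v (ℕ.≮⇒≥ b≮b') ⟩
      rank v b   ∎))
  where open ℕ.≤-Reasoning

star-crossing : ∀ {ℓ} {R : Rel X ℓ} (κ : X → Fin m) {x y} {s : Fin m} →
  Star R x y → κ x ≤ s → s < κ y → ∃[ p ] ∃[ p' ] (Star R x p × R p p' × κ p ≤ s × s < κ p')
star-crossing κ ε x≤s s<x = ⊥-elim (ℕ.<-irrefl refl (ℕ.≤-<-trans x≤s s<x))
star-crossing κ {s = s} (_◅_ {j = z} r rs) x≤s s<y with κ z ≤? s
... | yes z≤s = let p , p' , zp , e , bounds = star-crossing κ rs z≤s s<y
                in  p , p' , r ◅ zp , e , bounds
... | no z≰s  = _ , z , ε , r , x≤s , ℕ.≰⇒> z≰s

common-level : {x y x' y' : Fin m} → x < y → x' < y' → x < y' → x' < y →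
  Σ (Fin m) λ s → x ≤ s × s < y × x' ≤ s × s < y'
common-level {x = x} {x' = x'} x<y x'<y' x<y' x'<y with x ≤? x'
... | yes x≤x' = x' , x≤x' , x'<y , ℕ.≤-refl , x'<y'
... | no x≰x'  = x , ℕ.≤-refl , x<y , ℕ.<⇒≤ (ℕ.≰⇒> x≰x') , x<y'

-- In a matched pair (a , b) the A-end comes first, so this is the orientation A-end → B-end.
rises : (Fin m → Fin m) → Fin m × Fin m → Bool
rises κ (a , b) = does (κ a <? κ b)

rises-< : (κ : Fin m → Fin m) {a b : Fin m} → κ a < κ b → rises κ (a , b) ≡ true
rises-< κ {a} {b} = dec-true (κ a <? κ b)

rises-> : (κ : Fin m → Fin m) {a b : Fin m} → κ b < κ a → rises κ (a , b) ≡ false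
rises-> κ {a} {b} b<a = dec-false (κ a <? κ b) (ℕ.<-asym b<a)

Incident : Fin m → Fin m × Fin m → Set
Incident x (a , b) = x ≡ a ⊎ x ≡ b

Straddles : (Fin m → Fin m) → Fin m → Fin m × Fin m → Set
Straddles κ s (a , b) = (κ a ≤ s × s < κ b) ⊎ (κ b ≤ s × s < κ a)

module Matching (xs ys : List (Fin m)) where

  Comonotone : (Fin m → Fin m) → Set
  Comonotone κ = ZipMonotone κ xs ys × ZipMonotone κ ys xs

  private
    Z : List (Fin m × Fin m)
    Z = zip xs ys

    backward : ∀ {κ} → Comonotone κ → ∀ {a b a' b'} → (a , b) ∈ₗ Z → (a' , b') ∈ₗ Z →
      κ b < κ b' → κ a < κ a'
    backward (_ , mono) i i' = mono (zip-∈-swap i) (zip-∈-swap i')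

  rises-straddle : ∀ {κ s a b a' b'} → ZipMonotone κ xs ys → (a , b) ∈ₗ Z → (a' , b') ∈ₗ Z →
    Straddles κ s (a , b) → Straddles κ s (a' , b') → rises κ (a , b) ≡ rises κ (a' , b')
  rises-straddle {κ} _ _ _ (inj₁ (a≤s , s<b)) (inj₁ (a'≤s , s<b')) =
    trans (rises-< κ (ℕ.≤-<-trans a≤s s<b)) (sym (rises-< κ (ℕ.≤-<-trans a'≤s s<b')))
  rises-straddle {κ} _ _ _ (inj₂ (b≤s , s<a)) (inj₂ (b'≤s , s<a')) =
    trans (rises-> κ (ℕ.≤-<-trans b≤s s<a)) (sym (rises-> κ (ℕ.≤-<-trans b'≤s s<a')))
  rises-straddle mono i i' (inj₁ (a≤s , s<b)) (inj₂ (b'≤s , s<a')) =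
    ⊥-elim (ℕ.<-asym (mono i i' (ℕ.≤-<-trans a≤s s<a')) (ℕ.≤-<-trans b'≤s s<b))
  rises-straddle mono i i' (inj₂ (b≤s , s<a)) (inj₁ (a'≤s , s<b')) =
    ⊥-elim (ℕ.<-asym (mono i' i (ℕ.≤-<-trans a'≤s s<a)) (ℕ.≤-<-trans b≤s s<b'))

  rises-cut : ∀ {κ a b a' b' q} → Comonotone κ → (a , b) ∈ₗ Z → (a' , b') ∈ₗ Z →
    Incident q (a' , b') → Between (κ a) (κ q) (κ b) → rises κ (a' , b') ≡ rises κ (a , b)
  rises-cut {κ} co i i' (inj₁ refl) (inj₁ (a<q , q<b)) =
    trans (rises-< κ (ℕ.<-trans q<b (proj₁ co i i' a<q))) (sym (rises-< κ (ℕ.<-trans a<q q<b)))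
  rises-cut {κ} co i i' (inj₂ refl) (inj₁ (a<q , q<b)) =
    trans (rises-< κ (ℕ.<-trans (backward co i' i q<b) a<q)) (sym (rises-< κ (ℕ.<-trans a<q q<b)))
  rises-cut {κ} co i i' (inj₁ refl) (inj₂ (b<q , q<a)) =
    trans (rises-> κ (ℕ.<-trans (proj₁ co i' i q<a) b<q)) (sym (rises-> κ (ℕ.<-trans b<q q<a)))
  rises-cut {κ} co i i' (inj₂ refl) (inj₂ (b<q , q<a)) =
    trans (rises-> κ (ℕ.<-trans q<a (backward co i i' b<q))) (sym (rises-> κ (ℕ.<-trans b<q q<a)))

  rising-falling-disjoint : ∀ {κ a b a' b' x} → Comonotone κ → (a , b) ∈ₗ Z → (a' , b') ∈ₗ Z →
    κ a < κ b → κ b' < κ a' → Incident x (a , b) → Incident x (a' , b') → ⊥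
  rising-falling-disjoint co i i' a<b b'<a' (inj₁ refl) (inj₁ refl) =
    ℕ.<-irrefl refl (backward co i' i (ℕ.<-trans b'<a' a<b))
  rising-falling-disjoint co i i' a<b b'<a' (inj₂ refl) (inj₂ refl) =
    ℕ.<-irrefl refl (proj₁ co i i' (ℕ.<-trans a<b b'<a'))
  rising-falling-disjoint co i i' a<b b'<a' (inj₂ refl) (inj₁ refl) = ℕ.<-asym (proj₁ co i i' a<b) b'<a'
  rising-falling-disjoint co i i' a<b b'<a' (inj₁ refl) (inj₂ refl) = ℕ.<-asym (proj₁ co i i' b'<a') a<b

  rises-shared : ∀ {κ a b a' b' x} → Comonotone κ → (a , b) ∈ₗ Z → (a' , b') ∈ₗ Z →
    κ a ≢ κ b → κ a' ≢ κ b' → Incident x (a , b) → Incident x (a' , b') →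
    rises κ (a , b) ≡ rises κ (a' , b')
  rises-shared {κ} {a} {b} {a'} {b'} co i i' a≢b a'≢b' x∼e x∼e' with <-cmp (κ a) (κ b) | <-cmp (κ a') (κ b')
  ... | tri≈ _ a≡b _ | _ = ⊥-elim (a≢b a≡b)
  ... | _ | tri≈ _ a'≡b' _ = ⊥-elim (a'≢b' a'≡b')
  ... | tri< a<b _ _ | tri< a'<b' _ _ = trans (rises-< κ a<b) (sym (rises-< κ a'<b'))
  ... | tri> _ _ b<a | tri> _ _ b'<a' = trans (rises-> κ b<a) (sym (rises-> κ b'<a'))
  ... | tri< a<b _ _ | tri> _ _ b'<a' = ⊥-elim (rising-falling-disjoint co i i' a<b b'<a' x∼e x∼e')
  ... | tri> _ _ b<a | tri< a'<b' _ _ = ⊥-elim (rising-falling-disjoint co i' i a'<b' b<a x∼e' x∼e)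

module ChainGraph {n : ℕ} (A B : Subset n) where

  open Matching (remaining A) (remaining B)

  private variable
    v v' p p' q q' x y : Fin n

  positions-comonotone : Comonotone id
  positions-comonotone = sorted⇒zipMonotone (remaining-sorted A) (remaining-sorted B)
                       , sorted⇒zipMonotone (remaining-sorted B) (remaining-sorted A)

  values-comonotone : (σ : Permutation′ n) → reduce σ A ≡ reduce σ B → Comonotone (val σ)
  values-comonotone σ same = zipMonotone-map (val σ) (standardize≡⇒zipMonotone same)
                           , zipMonotone-map (val σ) (standardize≡⇒zipMonotone (sym same))

  edge-sym : Edge A B p p' → Edge A B p' p
  edge-sym (p≢p' , inj₁ i) = (λ eq → p≢p' (sym eq)) , inj₂ i
  edge-sym (p≢p' , inj₂ i) = (λ eq → p≢p' (sym eq)) , inj₁ i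

  link : Edge A B p p' → Fin n × Fin n
  link {p} {p'} (_ , inj₁ _) = p , p'
  link {p} {p'} (_ , inj₂ _) = p' , p

  link-∈ : (e : Edge A B p p') → link e ∈ₗ zip (remaining A) (remaining B)
  link-∈ (_ , inj₁ i) = i
  link-∈ (_ , inj₂ i) = i

  link-nontrivial : (e : Edge A B p p') → proj₁ (link e) ≢ proj₂ (link e)
  link-nontrivial (p≢p' , inj₁ _) = p≢p'
  link-nontrivial (p≢p' , inj₂ _) = λ eq → p≢p' (sym eq)

  link-incident : (e : Edge A B p p') → Incident p (link e)
  link-incident (_ , inj₁ _) = inj₁ refl
  link-incident (_ , inj₂ _) = inj₂ refl

  link-sym : (e : Edge A B p p') → link (edge-sym e) ≡ link e
  link-sym (_ , inj₁ _) = refl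
  link-sym (_ , inj₂ _) = refl

  link-between : (κ : Fin n → Fin n) (e : Edge A B p p') {y : Fin n} →
    Between (κ p) y (κ p') → Between (κ (proj₁ (link e))) y (κ (proj₂ (link e)))
  link-between κ (_ , inj₁ _) = id
  link-between κ (_ , inj₂ _) = swap

  link-straddles : (κ : Fin n → Fin n) (e : Edge A B p p') {s : Fin n} →
    κ p ≤ s → s < κ p' → Straddles κ s (link e)
  link-straddles κ (_ , inj₁ _) p≤s s<p' = inj₁ (p≤s , s<p')
  link-straddles κ (_ , inj₂ _) p≤s s<p' = inj₂ (p≤s , s<p')

  ascends : (Fin n → Fin n) → Edge A B p p' → Bool
  ascends κ e = rises κ (link e)

  ascends-adjacent : (e : Edge A B x p) (f : Edge A B x q) → ascends id e ≡ ascends id f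
  ascends-adjacent e f = rises-shared positions-comonotone (link-∈ e) (link-∈ f)
    (link-nontrivial e) (link-nontrivial f) (link-incident e) (link-incident f)

  ascends-path : Star (Edge A B) x y → (e : Edge A B x p) (f : Edge A B y q) → ascends id e ≡ ascends id f
  ascends-path ε e f = ascends-adjacent e f
  ascends-path (r ◅ rs) e f = begin
    ascends id e            ≡⟨ ascends-adjacent e r ⟩
    ascends id r            ≡⟨ cong (rises id) (link-sym r) ⟨
    ascends id (edge-sym r) ≡⟨ ascends-path rs (edge-sym r) f ⟩
    ascends id f            ∎
    where open ≡-Reasoning

  ascends-cut : (κ : Fin n → Fin n) → Comonotone κ → (e : Edge A B p p') →
    Between (κ p) (κ q) (κ p') → (f : Edge A B q q') → ascends κ f ≡ ascends κ e
  ascends-cut κ co e cut f = rises-cut co (link-∈ e) (link-∈ f) (link-incident f) (link-between κ e cut)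

  edge-at : IsChainVertex A B v → InChain A B v q → ∃[ q' ] Edge A B q q'
  edge-at v-edge ε = v-edge
  edge-at _ (e ◅ rs) = edge-at (_ , edge-sym e) rs

  chainEdge-sym : ChainEdge A B v p p' → ChainEdge A B v p' p
  chainEdge-sym (vp , e) = vp ◅◅ (e ◅ ε) , edge-sym e

  link-chainEdge : (c : ChainEdge A B v p p') →
    ChainEdge A B v (proj₁ (link (proj₂ c))) (proj₂ (link (proj₂ c)))
  link-chainEdge c@(_ , _ , inj₁ _) = c
  link-chainEdge c@(_ , _ , inj₂ _) = chainEdge-sym c

  Parallel : (Fin n → Fin n) → Fin n → Fin n → Set
  Parallel κ v v' = ∀ {p p' q q'} (c : ChainEdge A B v p p') (d : ChainEdge A B v' q q') →
    ascends κ (proj₂ c) ≡ ascends κ (proj₂ d)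

  chain-parallel : Parallel id v v
  chain-parallel (vp , e) (vq , f) = ascends-path (reverse edge-sym vp ◅◅ vq) e f

  record Aligned (κ : Fin n → Fin n) (v v' : Fin n) : Set where
    constructor aligned
    field
      {u u' w w'} : Fin n
      edge  : ChainEdge A B v u u'
      edge' : ChainEdge A B v' w w'
      same  : ascends κ (proj₂ edge) ≡ ascends κ (proj₂ edge')

  aligned⇒parallel : Aligned id v v' → Parallel id v v'
  aligned⇒parallel (aligned c c' c∥c') d d' = trans (chain-parallel d c) (trans c∥c' (chain-parallel c' d'))

  straddling-edge : (κ : Fin n → Fin n) {s : Fin n} → InChain A B v x → InChain A B v y →
    κ x ≤ s → s < κ y → ∃[ p ] ∃[ p' ] Σ (ChainEdge A B v p p') λ c → Straddles κ s (link (proj₂ c))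
  straddling-edge κ vx vy x≤s s<y =
    let p , p' , xp , e , p≤s , s<p' = star-crossing κ (reverse edge-sym vx ◅◅ vy) x≤s s<y
    in  p , p' , (vx ◅◅ xp , e) , link-straddles κ e p≤s s<p'

  -- OverlapH A B and OverlapV σ A B are definitionally OverlapBy id and OverlapBy (val σ).
  OverlapBy : (Fin n → Fin n) → Fin n → Fin n → Set
  OverlapBy κ v v' = ∃[ b ] ∃[ t ] ∃[ b' ] ∃[ t' ]
    (EndVertex A B v b × EndVertex A B v t × κ b < κ t
    × EndVertex A B v' b' × EndVertex A B v' t' × κ b' < κ t'
    × κ b < κ t' × κ b' < κ t)

  overlap⇒aligned : {κ : Fin n → Fin n} → ZipMonotone κ (remaining A) (remaining B) →
    OverlapBy κ v v' → Aligned κ v v'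
  overlap⇒aligned {κ = κ} mono
    (_ , _ , _ , _ , (vb , _) , (vt , _) , b<t , (vb' , _) , (vt' , _) , b'<t' , b<t' , b'<t)
    with common-level b<t b'<t' b<t' b'<t
  ... | s , b≤s , s<t , b'≤s , s<t'
    with straddling-edge κ vb vt b≤s s<t | straddling-edge κ vb' vt' b'≤s s<t'
  ... | _ , _ , c , c-straddles | _ , _ , c' , c'-straddles =
    aligned c c' (rises-straddle mono (link-∈ (proj₂ c)) (link-∈ (proj₂ c')) c-straddles c'-straddles)

  rises-increasing : (σ : Permutation′ n) → Increasing σ A B v → ChainEdge A B v p p' →
    rises (val σ) (p , p') ≡ rises id (p , p')
  rises-increasing {p = p} {p'} σ inc c@(_ , p≢p' , _) with <-cmp p p'
  ... | tri< p<p' _ _ = trans (rises-< (val σ) (inc _ _ c p<p')) (sym (rises-< id p<p'))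
  ... | tri≈ _ p≡p' _ = ⊥-elim (p≢p' p≡p')
  ... | tri> _ _ p'<p = trans (rises-> (val σ) (inc _ _ (chainEdge-sym c) p'<p)) (sym (rises-> id p'<p))

  rises-decreasing : (σ : Permutation′ n) → Decreasing σ A B v → ChainEdge A B v p p' →
    rises (val σ) (p , p') ≡ not (rises id (p , p'))
  rises-decreasing {p = p} {p'} σ dec c@(_ , p≢p' , _) with <-cmp p p'
  ... | tri< p<p' _ _ =
    trans (rises-> (val σ) (dec _ _ c p<p')) (sym (cong not (rises-< id p<p')))
  ... | tri≈ _ p≡p' _ = ⊥-elim (p≢p' p≡p')
  ... | tri> _ _ p'<p =
    trans (rises-< (val σ) (dec _ _ (chainEdge-sym c) p'<p)) (sym (cong not (rises-> id p'<p)))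

  ascends-increasing : (σ : Permutation′ n) → Increasing σ A B v → (c : ChainEdge A B v p p') →
    ascends (val σ) (proj₂ c) ≡ ascends id (proj₂ c)
  ascends-increasing σ inc c = rises-increasing σ inc (link-chainEdge c)

  ascends-decreasing : (σ : Permutation′ n) → Decreasing σ A B v → (c : ChainEdge A B v p p') →
    ascends (val σ) (proj₂ c) ≡ not (ascends id (proj₂ c))
  ascends-decreasing σ dec c = rises-decreasing σ dec (link-chainEdge c)

  aligned-increasing : (σ : Permutation′ n) → Increasing σ A B v → Increasing σ A B v' →
    Aligned (val σ) v v' → Aligned id v v'
  aligned-increasing σ inc inc' (aligned c c' c∥c') =
    aligned c c' (trans (sym (ascends-increasing σ inc c)) (trans c∥c' (ascends-increasing σ inc' c')))

  overlapping-increasing-parallel : (σ : Permutation′ n) → reduce σ A ≡ reduce σ B →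
    Increasing σ A B v → Increasing σ A B v' → OverlapH A B v v' ⊎ OverlapV σ A B v v' →
    Parallel id v v'
  overlapping-increasing-parallel σ same inc inc' (inj₁ overlapH) =
    aligned⇒parallel (overlap⇒aligned (proj₁ positions-comonotone) overlapH)
  overlapping-increasing-parallel σ same inc inc' (inj₂ overlapV) = aligned⇒parallel
    (aligned-increasing σ inc inc' (overlap⇒aligned (proj₁ (values-comonotone σ same)) overlapV))

corollary2p20 : (n k : ℕ) (σ : Permutation′ n) (A B : Subset n) →
    ∣ A ∣ ≡ k → ∣ B ∣ ≡ k → Disjoint A B → reduce σ A ≡ reduce σ B →
    (v₁ v₂ v' : Fin n) →
    IsChainVertex A B v₁ → Increasing σ A B v₁ →
    IsChainVertex A B v₂ → Increasing σ A B v₂ →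
    (OverlapH A B v₁ v₂ ⊎ OverlapV σ A B v₁ v₂) →
    IsChainVertex A B v' → Decreasing σ A B v' →
    ¬ (∃[ q₁ ] ∃[ q₂ ] (InChain A B v' q₁ × InChain A B v' q₂
        × (∃[ p ] ∃[ p' ] (ChainEdge A B v₁ p p' × CutsH σ q₁ p p'))
        × (∃[ p ] ∃[ p' ] (ChainEdge A B v₂ p p' × CutsV q₂ p p'))))
corollary2p20 n k σ A B _ _ _ same v₁ v₂ v' _ inc₁ _ inc₂ C₁C₂-overlap v'-edge dec'
  (q₁ , q₂ , v'q₁ , v'q₂ , (_ , _ , c₁ , q₁-cuts) , (_ , _ , c₂ , q₂-cuts)) =
  not-¬ directions-agree (ascends-decreasing σ dec' w₁)
  where
  open ChainGraph A B
  open ≡-Reasoning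
  w₁ : ChainEdge A B v' q₁ _
  w₁ = v'q₁ , proj₂ (edge-at v'-edge v'q₁)
  w₂ : ChainEdge A B v' q₂ _
  w₂ = v'q₂ , proj₂ (edge-at v'-edge v'q₂)
  directions-agree : ascends (val σ) (proj₂ w₁) ≡ ascends id (proj₂ w₁)
  directions-agree = begin
    ascends (val σ) (proj₂ w₁)
      ≡⟨ ascends-cut (val σ) (values-comonotone σ same) (proj₂ c₁) q₁-cuts (proj₂ w₁) ⟩
    ascends (val σ) (proj₂ c₁)
      ≡⟨ ascends-increasing σ inc₁ c₁ ⟩
    ascends id (proj₂ c₁)
      ≡⟨ overlapping-increasing-parallel σ same inc₁ inc₂ C₁C₂-overlap c₁ c₂ ⟩
    ascends id (proj₂ c₂)
      ≡⟨ ascends-cut id positions-comonotone (proj₂ c₂) q₂-cuts (proj₂ w₂) ⟨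
    ascends id (proj₂ w₂)
      ≡⟨ chain-parallel w₂ w₁ ⟩
    ascends id (proj₂ w₁)
      ∎
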